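{- Let $\lambda$ be a nonzero real number and $r\geq 0$ an integer. Let $a,a^\dagger$ be the boson annihilation and creation operators and $\hat{n}=a^\dagger a$ the number operator. Then for every integer $n\geq 0$, $$(\hat{n}+r)_{n,\lambda}=(a^\dagger a+r)_{n,\lambda}=\sum_{k=0}^n \begin{Bmatrix}n+r \\ k+r \end{Bmatrix}_{r,\lambda}(a^\dagger)^k a^k,$$ and for every integer $n\geq r$, $$(\hat{n})_{n-r,\lambda}(a^\dagger)^r a^r=(a^\dagger a)_{n-r,\lambda}(a^\dagger)^r a^r=\sum_{k=r}^n \begin{Bmatrix}n \\ k \end{Bmatrix}_{r,\lambda} (a^\dagger)^{k} a^k.$$
   Context: Degenerate falling factorials: $(x)_{0,\lambda}=1$ and $(x)_{k,\lambda}=x(x-\lambda)\cdots(x-(k-1)\lambda)$ for $k\geq1$; for an operator $X$, $(X)_{k,\lambda}=X(X-\lambda)\cdots(X-(k-1)\lambda)$ (with $X+c$ meaning $X+c\cdot\mathrm{Id}$). Ordinary falling factorials: $(x)_0=1$, $(x)_k=x(x-1)\cdots(x-k+1)$. For an integer $r\geq0$, the degenerate $r$-Stirling numbers of the second kind $\begin{Bmatrix}n+r \\ k+r \end{Bmatrix}_{r,\lambda}$ ($0\le k\le n$) are defined by the polynomial identity $(x+r)_{n,\lambda}=\sum_{k=0}^n \begin{Bmatrix}n+r \\ k+r \end{Bmatrix}_{r,\lambda}(x)_k$ for all $n\geq0$; for integers $n\ge k\ge r$, the symbol $\begin{Bmatrix}n \\ k \end{Bmatrix}_{r,\lambda}$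 denotes $\begin{Bmatrix}(n-r)+r \\ (k-r)+r \end{Bmatrix}_{r,\lambda}$. Boson operators: on the space spanned by orthonormal number states $|m\rangle$, $m=0,1,2,\dots$, one has $a|m\rangle=\sqrt{m}\,|m-1\rangle$ (with $a|0\rangle=0$) and $a^\dagger|m\rangle=\sqrt{m+1}\,|m+1\rangle$, so that $aa^\dagger-a^\dagger a=1$ and $\hat n|m\rangle=m|m\rangle$. The identities are equalities of operators on this space. -}

module Defs where

open import Level using (Level)
open import Data.Nat using (ℕ; zero; suc; _∸_)
open import Algebra.Bundles using (CommutativeRing)

-- Everything is parametrised by the scalar ring R (standing in for ℝ, which
-- agda-stdlib lacks) and by a choice of square roots sq m of the numbers m.
module Boson {c ℓ : Level} (R : CommutativeRing c ℓ) (sq : ℕ → CommutativeRing.Carrier R) where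

  open CommutativeRing R hiding (zero)

  ι : ℕ → Carrier
  ι zero    = 0#
  ι (suc m) = 1# + ι m

  Σ≤ : ℕ → (ℕ → Carrier) → Carrier
  Σ≤ zero    f = f zero
  Σ≤ (suc n) f = Σ≤ n f + f (suc n)

  dff : Carrier → Carrier → ℕ → Carrier
  dff x l zero    = 1#
  dff x l (suc k) = dff x l k * (x - ι k * l)

  ff : Carrier → ℕ → Carrier
  ff x k = dff x 1# k

  -- States: coefficient sequences  v = Σ_m v(m) |m⟩  (|m⟩ = δ_m).
  State : Set c
  State = ℕ → Carrier

  Op : Set c
  Op = State → State

  infix 4 _≋_
  infixr 9 _∘ₒ_
  infixl 6 _⊕_
  infixr 7 _·ₒ_
  infixr 8 _^ₒ_

  _≋_ : Op → Op → Set (c Level.⊔ ℓ)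
  X ≋ Y = ∀ (v : State) (m : ℕ) → X v m ≈ Y v m

  idₒ : Op
  idₒ v = v

  _∘ₒ_ : Op → Op → Op
  (X ∘ₒ Y) v = X (Y v)

  _⊕_ : Op → Op → Op
  (X ⊕ Y) v m = X v m + Y v m

  _·ₒ_ : Carrier → Op → Op
  (s ·ₒ X) v m = s * X v m

  zeroₒ : Op
  zeroₒ v m = 0#

  _^ₒ_ : Op → ℕ → Op
  X ^ₒ zero    = idₒ
  X ^ₒ (suc k) = X ∘ₒ (X ^ₒ k)

  _+ₛ_ : Op → Carrier → Op
  X +ₛ s = X ⊕ (s ·ₒ idₒ)

  dffₒ : Op → Carrier → ℕ → Op
  dffₒ X l zero    = idₒ
  dffₒ X l (suc k) = dffₒ X l k ∘ₒ (X +ₛ (- (ι k * l)))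

  Σₒ≤ : ℕ → (ℕ → Op) → Op
  Σₒ≤ zero    F = F zero
  Σₒ≤ (suc n) F = Σₒ≤ n F ⊕ F (suc n)

  Σₒ[_⋯_] : ℕ → ℕ → (ℕ → Op) → Op
  Σₒ[ lo ⋯ hi ] F = Σₒ≤ (hi ∸ lo) (λ i → F (lo Data.Nat.+ i))

  -- boson operators:  a|m⟩ = √m |m-1⟩,  a†|m⟩ = √(m+1) |m+1⟩
  a : Op
  a v m = sq (suc m) * v (suc m)

  a† : Op
  a† v zero    = 0#
  a† v (suc m) = sq (suc m) * v m

  n̂ : Op
  n̂ = a† ∘ₒ a

{-# OPTIONS --safe #-}
-- Both sides of each identity act diagonally on the number states: n̂ has
-- eigenvalue m on |m⟩ and the normally ordered product (a†)^k a^k has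
-- eigenvalue (m)_k.  Hence every operator involved is multiplication by a
-- function of m, and each identity reduces to the defining expansion of the
-- degenerate r-Stirling numbers evaluated at x = m, resp. at x = m - r after
-- using (m)_r (m - r)_i = (m)_{r+i}.
module Submission where

open import Defs
open import Level using (Level)
open import Data.Nat as ℕ using (ℕ; zero; suc; _≤_; _∸_)
import Data.Nat.Properties as ℕₚ
open import Data.Product using (_×_; _,_)
open import Relation.Nullary using (¬_)
open import Relation.Binary.PropositionalEquality as ≡ using (_≡_)
open import Algebra.Bundles using (CommutativeRing)
import Algebra.Properties.Ring as RingProperties
import Algebra.Solver.CommutativeMonoid as CommutativeMonoidSolver

module BosonCalculus {c ℓ : Level} (R : CommutativeRing c ℓ) (sq : ℕ → CommutativeRing.Carrier R) where
  open CommutativeRing R hiding (zero)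
  open RingProperties ring using (-‿+-comm; -0#≈0#; //-rightDividesˡ; //-rightDividesʳ)
  open Boson R sq
  open import Relation.Binary.Reasoning.Setoid setoid
  open CommutativeMonoidSolver *-commutativeMonoid using (solve; _⊜_) renaming (_⊕_ to _⊗_)

  x-[y+z]≈x-y-z : ∀ x y z → x - (y + z) ≈ (x - y) - z
  x-[y+z]≈x-y-z x y z = trans (+-congˡ (sym (-‿+-comm y z))) (sym (+-assoc x (- y) (- z)))

  ι-+ : ∀ m n → ι (m ℕ.+ n) ≈ ι m + ι n
  ι-+ zero    n = sym (+-identityˡ (ι n))
  ι-+ (suc m) n = trans (+-congˡ (ι-+ m n)) (sym (+-assoc 1# (ι m) (ι n)))

  dff-cong : ∀ {x y} l k → x ≈ y → dff x l k ≈ dff y l k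
  dff-cong l zero    x≈y = refl
  dff-cong l (suc k) x≈y = *-cong (dff-cong l k x≈y) (+-congʳ x≈y)

  dff-sucˡ : ∀ x l k → dff x l (suc k) ≈ x * dff (x - l) l k
  dff-sucˡ x l zero = begin
    1# * (x - 0# * l) ≈⟨ *-identityˡ _ ⟩
    x - 0# * l        ≈⟨ +-congˡ (trans (-‿cong (zeroˡ l)) -0#≈0#) ⟩
    x + 0#            ≈⟨ +-identityʳ x ⟩
    x                 ≈⟨ *-identityʳ x ⟨
    x * 1#            ∎
  dff-sucˡ x l (suc k) = begin
    dff x l (suc k) * (x - (1# + ι k) * l)
      ≈⟨ *-cong (dff-sucˡ x l k) (+-congˡ (-‿cong (trans (distribʳ l 1# (ι k)) (+-congʳ (*-identityˡ l))))) ⟩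
    x * dff (x - l) l k * (x - (l + ι k * l))
      ≈⟨ *-assoc x _ _ ⟩
    x * (dff (x - l) l k * (x - (l + ι k * l)))
      ≈⟨ *-congˡ (*-congˡ (x-[y+z]≈x-y-z x l (ι k * l))) ⟩
    x * (dff (x - l) l k * ((x - l) - ι k * l)) ∎

  dff-0#-suc : ∀ l k → dff 0# l (suc k) ≈ 0#
  dff-0#-suc l k = trans (dff-sucˡ 0# l k) (zeroˡ _)

  ff-1+-suc : ∀ x k → ff (1# + x) (suc k) ≈ (1# + x) * ff x k
  ff-1+-suc x k = trans (dff-sucˡ (1# + x) 1# k) (*-congˡ (dff-cong 1# k 1+x-1≈x))
    where
    1+x-1≈x : (1# + x) - 1# ≈ x
    1+x-1≈x = trans (+-congʳ (+-comm 1# x)) (//-rightDividesʳ 1# x)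

  ff-+ : ∀ x m n → ff x (m ℕ.+ n) ≈ ff x m * ff (x - ι m) n
  ff-+ x m zero = begin
    ff x (m ℕ.+ 0) ≡⟨ ≡.cong (ff x) (ℕₚ.+-identityʳ m) ⟩
    ff x m         ≈⟨ *-identityʳ (ff x m) ⟨
    ff x m * 1#    ∎
  ff-+ x m (suc n) = begin
    ff x (m ℕ.+ suc n)
      ≡⟨ ≡.cong (ff x) (ℕₚ.+-suc m n) ⟩
    ff x (m ℕ.+ n) * (x - ι (m ℕ.+ n) * 1#)
      ≈⟨ *-cong (ff-+ x m n) (+-congˡ (-‿cong (*-identityʳ _))) ⟩
    ff x m * ff (x - ι m) n * (x - ι (m ℕ.+ n))
      ≈⟨ *-congˡ (+-congˡ (-‿cong (ι-+ m n))) ⟩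
    ff x m * ff (x - ι m) n * (x - (ι m + ι n))
      ≈⟨ *-assoc (ff x m) _ _ ⟩
    ff x m * (ff (x - ι m) n * (x - (ι m + ι n)))
      ≈⟨ *-congˡ (*-congˡ (trans (x-[y+z]≈x-y-z x (ι m) (ι n)) (+-congˡ (-‿cong (sym (*-identityʳ (ι n))))))) ⟩
    ff x m * (ff (x - ι m) n * ((x - ι m) - ι n * 1#)) ∎

  Σ≤-cong : ∀ n {f g : ℕ → Carrier} → (∀ k → f k ≈ g k) → Σ≤ n f ≈ Σ≤ n g
  Σ≤-cong zero    f≈g = f≈g zero
  Σ≤-cong (suc n) f≈g = +-cong (Σ≤-cong n f≈g) (f≈g (suc n))

  Σ≤-distribʳ : ∀ n (f : ℕ → Carrier) x → Σ≤ n f * x ≈ Σ≤ n (λ k → f k * x)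
  Σ≤-distribʳ zero    f x = refl
  Σ≤-distribʳ (suc n) f x = trans (distribʳ x _ _) (+-congʳ (Σ≤-distribʳ n f x))

  dff-*-ff-expansion : ∀ (S : ℕ → ℕ → Carrier) l r →
    (∀ n x → dff (x + ι r) l n ≈ Σ≤ n (λ k → S n k * ff x k)) →
    ∀ N x → dff x l N * ff x r ≈ Σ≤ N (λ i → S N i * ff x (r ℕ.+ i))
  dff-*-ff-expansion S l r expand N x = begin
    dff x l N * ff x r
      ≈⟨ *-congʳ (dff-cong l N (sym (//-rightDividesˡ (ι r) x))) ⟩
    dff ((x - ι r) + ι r) l N * ff x r
      ≈⟨ *-congʳ (expand N (x - ι r)) ⟩
    Σ≤ N (λ i → S N i * ff (x - ι r) i) * ff x r
      ≈⟨ Σ≤-distribʳ N _ (ff x r) ⟩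
    Σ≤ N (λ i → S N i * ff (x - ι r) i * ff x r)
      ≈⟨ Σ≤-cong N (λ i → trans (*-assoc _ _ _) (*-congˡ (trans (*-comm _ _) (sym (ff-+ x r i))))) ⟩
    Σ≤ N (λ i → S N i * ff x (r ℕ.+ i)) ∎

  Diagonal : (ℕ → Carrier) → Op → Set (c Level.⊔ ℓ)
  Diagonal f X = ∀ v m → X v m ≈ f m * v m

  diagonal-≋ : ∀ {f g X Y} → Diagonal f X → Diagonal g Y → (∀ m → f m ≈ g m) → X ≋ Y
  diagonal-≋ dX dY f≈g v m = trans (dX v m) (trans (*-congʳ (f≈g m)) (sym (dY v m)))

  ∘ₒ-diagonal : ∀ {f g X Y} → Diagonal f X → Diagonal g Y → Diagonal (λ m → f m * g m) (X ∘ₒ Y)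
  ∘ₒ-diagonal {f} {g} {X} {Y} dX dY v m = begin
    X (Y v) m         ≈⟨ dX (Y v) m ⟩
    f m * Y v m       ≈⟨ *-congˡ (dY v m) ⟩
    f m * (g m * v m) ≈⟨ *-assoc (f m) (g m) (v m) ⟨
    f m * g m * v m   ∎

  +ₛ-diagonal : ∀ {f X} s → Diagonal f X → Diagonal (λ m → f m + s) (X +ₛ s)
  +ₛ-diagonal s dX v m = trans (+-congʳ (dX v m)) (sym (distribʳ (v m) _ _))

  ·ₒ-diagonal : ∀ {f X} s → Diagonal f X → Diagonal (λ m → s * f m) (s ·ₒ X)
  ·ₒ-diagonal s dX v m = trans (*-congˡ (dX v m)) (sym (*-assoc s _ (v m)))

  Σₒ≤-diagonal : ∀ n {f : ℕ → ℕ → Carrier} {F : ℕ → Op} →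
    (∀ k → Diagonal (f k) (F k)) → Diagonal (λ m → Σ≤ n (λ k → f k m)) (Σₒ≤ n F)
  Σₒ≤-diagonal zero    dF v m = dF zero v m
  Σₒ≤-diagonal (suc n) dF v m =
    trans (+-cong (Σₒ≤-diagonal n dF v m) (dF (suc n) v m)) (sym (distribʳ (v m) _ _))

  dffₒ-diagonal : ∀ {f X} l k → Diagonal f X → Diagonal (λ m → dff (f m) l k) (dffₒ X l k)
  dffₒ-diagonal l zero    dX v m = sym (*-identityˡ (v m))
  dffₒ-diagonal l (suc k) dX = ∘ₒ-diagonal (dffₒ-diagonal l k dX) (+ₛ-diagonal _ dX)

  ^ₒ-suc-apply : ∀ X k v → (X ^ₒ suc k) v ≡ (X ^ₒ k) (X v)
  ^ₒ-suc-apply X zero    v = ≡.refl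
  ^ₒ-suc-apply X (suc k) v = ≡.cong X (^ₒ-suc-apply X k v)

  module WithSquareRoots (sq² : ∀ m → sq m * sq m ≈ ι m) where

    n̂-diagonal : Diagonal ι n̂
    n̂-diagonal v zero    = sym (zeroˡ (v zero))
    n̂-diagonal v (suc m) = trans (sym (*-assoc _ _ _)) (*-congʳ (sq² (suc m)))

    normalOrdered-diagonal : ∀ k → Diagonal (λ m → ff (ι m) k) ((a† ^ₒ k) ∘ₒ (a ^ₒ k))
    normalOrdered-diagonal zero    v m       = sym (*-identityˡ (v m))
    normalOrdered-diagonal (suc k) v zero    = sym (trans (*-congʳ (dff-0#-suc 1# k)) (zeroˡ (v zero)))
    normalOrdered-diagonal (suc k) v (suc m) = begin
      sq (suc m) * (a† ^ₒ k) ((a ^ₒ suc k) v) m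
        ≡⟨ ≡.cong (λ w → sq (suc m) * (a† ^ₒ k) w m) (^ₒ-suc-apply a k v) ⟩
      sq (suc m) * (a† ^ₒ k) ((a ^ₒ k) (a v)) m
        ≈⟨ *-congˡ (normalOrdered-diagonal k (a v) m) ⟩
      sq (suc m) * (ff (ι m) k * (sq (suc m) * v (suc m)))
        ≈⟨ solve 3 (λ s f w → s ⊗ (f ⊗ (s ⊗ w)) ⊜ ((s ⊗ s) ⊗ f) ⊗ w) refl (sq (suc m)) (ff (ι m) k) (v (suc m)) ⟩
      sq (suc m) * sq (suc m) * ff (ι m) k * v (suc m)
        ≈⟨ *-congʳ (trans (*-congʳ (sq² (suc m))) (sym (ff-1+-suc (ι m) k))) ⟩
      ff (ι (suc m)) (suc k) * v (suc m) ∎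

    module StirlingExpansion (S : ℕ → ℕ → Carrier) (l : Carrier) (r : ℕ)
             (expand : ∀ n x → dff (x + ι r) l n ≈ Σ≤ n (λ k → S n k * ff x k)) where

      dffₒ-shifted-normalOrdered : ∀ n →
        dffₒ (n̂ +ₛ ι r) l n ≋ Σₒ≤ n (λ k → S n k ·ₒ ((a† ^ₒ k) ∘ₒ (a ^ₒ k)))
      dffₒ-shifted-normalOrdered n =
        diagonal-≋ (dffₒ-diagonal l n (+ₛ-diagonal (ι r) n̂-diagonal))
                   (Σₒ≤-diagonal n (λ k → ·ₒ-diagonal (S n k) (normalOrdered-diagonal k)))
                   (λ m → expand n (ι m))

      dffₒ-truncated-normalOrdered : ∀ n →
        dffₒ n̂ l (n ∸ r) ∘ₒ ((a† ^ₒ r) ∘ₒ (a ^ₒ r))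
          ≋ Σₒ[ r ⋯ n ] (λ k → S (n ∸ r) (k ∸ r) ·ₒ ((a† ^ₒ k) ∘ₒ (a ^ₒ k)))
      dffₒ-truncated-normalOrdered n =
        diagonal-≋ (∘ₒ-diagonal (dffₒ-diagonal l N n̂-diagonal) (normalOrdered-diagonal r))
                   (Σₒ≤-diagonal N (λ i → ·ₒ-diagonal (S N ((r ℕ.+ i) ∸ r)) (normalOrdered-diagonal (r ℕ.+ i))))
                   (λ m → trans (dff-*-ff-expansion S l r expand N (ι m)) (Σ≤-cong N (λ i → S-index i _)))
        where
        N : ℕ
        N = n ∸ r
        S-index : ∀ i x → S N i * x ≈ S N ((r ℕ.+ i) ∸ r) * x
        S-index i x = *-congʳ (reflexive (≡.cong (S N) (≡.sym (ℕₚ.m+n∸m≡n r i))))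

theorem1 : ∀ {c ℓ : Level} (R : CommutativeRing c ℓ) (sq : ℕ → CommutativeRing.Carrier R) →
    let open CommutativeRing R hiding (zero)
        open Boson R sq
    in (∀ m → sq m * sq m ≈ ι m) →
       (l : Carrier) → ¬ (l ≈ 0#) →
       (r : ℕ) →
       (S : ℕ → ℕ → Carrier) →
       (∀ (n : ℕ) (x : Carrier) → dff (x + ι r) l n ≈ Σ≤ n (λ k → S n k * ff x k)) →
       (∀ (n : ℕ) →
          (dffₒ (n̂ +ₛ ι r) l n ≋ dffₒ ((a† ∘ₒ a) +ₛ ι r) l n)
          × (dffₒ ((a† ∘ₒ a) +ₛ ι r) l n ≋ Σₒ≤ n (λ k → S n k ·ₒ ((a† ^ₒ k) ∘ₒ (a ^ₒ k)))))
       × (∀ (n : ℕ) → r ≤ n →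
          (dffₒ n̂ l (n ∸ r) ∘ₒ ((a† ^ₒ r) ∘ₒ (a ^ₒ r))
             ≋ dffₒ (a† ∘ₒ a) l (n ∸ r) ∘ₒ ((a† ^ₒ r) ∘ₒ (a ^ₒ r)))
          × (dffₒ (a† ∘ₒ a) l (n ∸ r) ∘ₒ ((a† ^ₒ r) ∘ₒ (a ^ₒ r))
             ≋ Σₒ[ r ⋯ n ] (λ k → S (n ∸ r) (k ∸ r) ·ₒ ((a† ^ₒ k) ∘ₒ (a ^ₒ k)))))
theorem1 R sq sq² l _ r S expand =
    (λ n → (λ _ _ → refl) , dffₒ-shifted-normalOrdered n)
  , (λ n _ → (λ _ _ → refl) , dffₒ-truncated-normalOrdered n)
  where
  open CommutativeRing R using (refl)
  open BosonCalculus R sq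
  open WithSquareRoots sq²
  open StirlingExpansion S l r expand
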